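{- Let $H$ be a bipartite graph and let $G$ be a graph that admits a simultaneous $s$-stack $q$-queue layout. Then (i) $\mathrm{sn}(H \,\square\, G) \le s + \mathrm{dsn}(H)$; (ii) $\mathrm{sn}(H \times G) \le 2q\cdot \mathrm{dsn}(H)$; (iii) $\mathrm{sn}(H \boxtimes G) \le 2q\cdot \mathrm{dsn}(H) + s + \mathrm{dsn}(H)$.
   Context: All graphs are finite, simple and undirected. A vertex order $\sigma$ of a graph is a total order of its vertices. Two edges $(u,v)$ and $(x,y)$ cross with respect to $\sigma$ if $u <_\sigma x <_\sigma v <_\sigma y$, and nest if $u <_\sigma x <_\sigma y <_\sigma v$. A $k$-stack layout is a vertex order together with a partition of the edge set into $k$ sets (stacks) of pairwise non-crossing edges; a $k$-queue layout is a vertex order with a partition of the edges into $k$ sets (queues) of pairwise non-nested edges. The stack number $\mathrm{sn}(G)$ is the minimum $k$ such that $G$ has a $k$-stack layout. A simultaneous $s$-stack $q$-queue layout of $G$ is a single vertex order $\sigma$ together with a partition of $E(G)$ into $s$ stacks with respect to $\sigma$ and (independently) a partition of $E(G)$ into $q$ queues with respect to $\sigma$ (each edge lies in one stack and in one queue). A dispersable stack layout is a stack layout in which the edges of each stack form a matching (pairwise vertex-disjoint edges); the dispersable stack number $\mathrm{dsn}(H)$ is the minimum number of stacks in a dispersable stack layout of $H$. For graphs $A,B$, products are defined on $V(A)\times V(B)$; a pair $(v,x),(u,y)$ is an $A$-edge if $v=u$ and $(x,y)\in E(B)$, a $B$-edge if $x=y$ and $(v,u)\in E(A)$, and a direct edge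 if $(v,u)\in E(A)$ and $(x,y)\in E(B)$. The cartesian product $A\,\square\,B$ has the $A$-edges and $B$-edges; the direct product $A\times B$ has the direct edges; the strong product $A\boxtimes B$ has all three kinds. -}

module Defs where

open import Data.Nat using (ℕ; _<_; _≤_; _+_; _*_)
open import Data.Fin using (Fin)
open import Data.Product using (Σ; ∃; ∃-syntax; _×_; _,_; proj₁; proj₂)
open import Data.Sum using (_⊎_; inj₁; inj₂)
open import Data.Bool using (Bool)
open import Data.List using (List; cartesianProduct)
open import Data.List.Membership.Propositional using (_∈_)
open import Data.List.Membership.Propositional.Properties using (∈-cartesianProduct⁺)
open import Data.Empty using (⊥)
open import Relation.Nullary using (¬_)
open import Relation.Binary.PropositionalEquality using (_≡_; _≢_; refl; sym)

record Graph : Set₁ where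
  field
    V        : Set
    vertices : List V                 -- finiteness: a list containing
    complete : ∀ v → v ∈ vertices     -- every vertex
    E        : V → V → Set
    E-sym    : ∀ {u v} → E u v → E v u
    E-irr    : ∀ {v} → ¬ E v v
open Graph public

Bipartite : Graph → Set
Bipartite G = Σ (V G → Bool) λ side → ∀ {u v} → E G u v → side u ≢ side v

record VertexOrder (G : Graph) : Set where
  field
    pos    : V G → ℕ
    pos-inj : ∀ {u v} → pos u ≡ pos v → u ≡ v
open VertexOrder public

module _ {G : Graph} (σ : VertexOrder G) where
  _<σ_ : V G → V G → Set
  u <σ v = pos σ u < pos σ v

  Cross : V G → V G → V G → V G → Set
  Cross u v x y = (u <σ x) × (x <σ v) × (v <σ y)

  Nest : V G → V G → V G → V G → Set
  Nest u v x y = (u <σ x) × (x <σ y) × (y <σ v)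

-- An assignment of edges to k classes: a function on vertex pairs, symmetric
-- on edges (so it is a function of the unordered edge).
record EdgePartition (G : Graph) (k : ℕ) : Set where
  field
    col     : V G → V G → Fin k
    col-sym : ∀ {u v} → E G u v → col u v ≡ col v u
open EdgePartition public

IsStackPartition : {G : Graph} {k : ℕ} → VertexOrder G → EdgePartition G k → Set
IsStackPartition {G} σ P =
  ∀ {u v x y} → E G u v → E G x y → col P u v ≡ col P x y → ¬ Cross σ u v x y

IsQueuePartition : {G : Graph} {k : ℕ} → VertexOrder G → EdgePartition G k → Set
IsQueuePartition {G} σ P =
  ∀ {u v x y} → E G u v → E G x y → col P u v ≡ col P x y → ¬ Nest σ u v x y

IsMatchingPartition : {G : Graph} {k : ℕ} → EdgePartition G k → Set
IsMatchingPartition {G} P =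
  ∀ {u v w} → E G u v → E G u w → col P u v ≡ col P u w → v ≡ w

record StackLayout (G : Graph) (k : ℕ) : Set where
  field
    order  : VertexOrder G
    stacks : EdgePartition G k
    valid  : IsStackPartition order stacks

record DispersableStackLayout (G : Graph) (k : ℕ) : Set where
  field
    order    : VertexOrder G
    stacks   : EdgePartition G k
    valid    : IsStackPartition order stacks
    matching : IsMatchingPartition stacks

record SimultaneousLayout (G : Graph) (s q : ℕ) : Set where
  field
    order    : VertexOrder G
    stacks   : EdgePartition G s
    queues   : EdgePartition G q
    stacksOK : IsStackPartition order stacks
    queuesOK : IsQueuePartition order queues

SnAtMost : Graph → ℕ → Set
SnAtMost G k = ∃[ k' ] (k' ≤ k × StackLayout G k')

IsDsn : Graph → ℕ → Set
IsDsn H d = DispersableStackLayout H d × (∀ j → DispersableStackLayout H j → d ≤ j)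

module _ (A B : Graph) where
  private
    W = V A × V B

  AEdge : W → W → Set
  AEdge (v , x) (u , y) = (v ≡ u) × E B x y

  BEdge : W → W → Set
  BEdge (v , x) (u , y) = (x ≡ y) × E A v u

  DEdge : W → W → Set
  DEdge (v , x) (u , y) = E A v u × E B x y

  private
    verts : List W
    verts = cartesianProduct (vertices A) (vertices B)
    comp : ∀ w → w ∈ verts
    comp (v , x) = ∈-cartesianProduct⁺ (complete A v) (complete B x)

    AE-sym : ∀ {w z} → AEdge w z → AEdge z w
    AE-sym (refl , e) = refl , E-sym B e
    BE-sym : ∀ {w z} → BEdge w z → BEdge z w
    BE-sym (refl , e) = refl , E-sym A e
    DE-sym : ∀ {w z} → DEdge w z → DEdge z w
    DE-sym (e , f) = E-sym A e , E-sym B f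
    AE-irr : ∀ {w} → ¬ AEdge w w
    AE-irr (_ , e) = E-irr B e
    BE-irr : ∀ {w} → ¬ BEdge w w
    BE-irr (_ , e) = E-irr A e
    DE-irr : ∀ {w} → ¬ DEdge w w
    DE-irr (e , _) = E-irr A e

  _□_ : Graph
  _□_ = record
    { V = W ; vertices = verts ; complete = comp
    ; E = λ w z → AEdge w z ⊎ BEdge w z
    ; E-sym = λ { (inj₁ e) → inj₁ (AE-sym e) ; (inj₂ e) → inj₂ (BE-sym e) }
    ; E-irr = λ { (inj₁ e) → AE-irr e ; (inj₂ e) → BE-irr e } }

  _⨯_ : Graph
  _⨯_ = record
    { V = W ; vertices = verts ; complete = comp
    ; E = DEdge ; E-sym = DE-sym ; E-irr = DE-irr }

  _⊠_ : Graph
  _⊠_ = record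
    { V = W ; vertices = verts ; complete = comp
    ; E = λ w z → AEdge w z ⊎ BEdge w z ⊎ DEdge w z
    ; E-sym = λ { (inj₁ e) → inj₁ (AE-sym e)
                ; (inj₂ (inj₁ e)) → inj₂ (inj₁ (BE-sym e))
                ; (inj₂ (inj₂ e)) → inj₂ (inj₂ (DE-sym e)) }
    ; E-irr = λ { (inj₁ e) → AE-irr e
                ; (inj₂ (inj₁ e)) → BE-irr e
                ; (inj₂ (inj₂ e)) → DE-irr e } }

-- Order the product block by block along a dispersable layout of H, each block a copy of the
-- order of G that is reversed on one colour class of H. Edges inside a block reuse the stacks of G.
-- Two H-edges of one dispersable stack that weakly interleave share both endpoints, since stacks
-- are matchings, and the two blocks they join carry opposite orders. This forbids crossings between
-- copies of one H-edge, and turns a crossing of two direct edges into a nesting of their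
-- G-projections. Hence direct edges may share a stack when they agree in H-stack, G-queue and
-- direction within their first block, which needs 2q · dsn(H) stacks.
module Submission where

open import Defs
open import Level using (0ℓ)
open import Data.Nat using (ℕ; _+_; _*_; _∸_; suc; s≤s; _≤_; _<_; _≟_; _<?_; NonZero)
open import Data.Nat.Properties
open import Data.Nat.DivMod using (_/_; _%_; +-distrib-/; m*n%n≡0; m<n⇒m%n≡m; m*n/n≡m; m<n⇒m/n≡0; /-monoˡ-≤)
open import Data.Fin using (Fin; zero; suc; join; splitAt; combine)
open import Data.Fin.Properties using (splitAt-join; combine-injective) renaming (0≢1+n to 0F≢1+n)
open import Data.Product using (_×_; _,_; proj₁; proj₂)
open import Data.Sum using (_⊎_; inj₁; inj₂; [_,_])
open import Data.Sum.Properties using (inj₁-injective; inj₂-injective)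
open import Data.Bool using (Bool; true; false)
open import Data.List using (map)
open import Data.List.Relation.Unary.All using (lookup)
open import Data.List.Membership.Propositional.Properties using (∈-map⁺)
import Data.List.Extrema ≤-totalOrder as Extrema
open import Data.Empty using (⊥; ⊥-elim)
open import Relation.Nullary using (¬_; yes; no; contradiction)
open import Relation.Nullary.Decidable using (map′)
open import Relation.Binary.Core using (Rel; _⇒_)
open import Relation.Binary.Definitions using (tri<; tri≈; tri>; Decidable; DecidableEquality; Symmetric)
open import Relation.Binary.Construct.Union using (_∪_)
open import Relation.Binary.PropositionalEquality using (_≡_; _≢_; refl; sym; trans; cong; cong₂; subst; module ≡-Reasoning)

Opposite : {G : Graph} → VertexOrder G → VertexOrder G → Set
Opposite {G} π π′ = ∀ {x y : V G} → pos π x < pos π y → pos π′ y < pos π′ x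

module _ {G : Graph} (σ : VertexOrder G) where

  decEq : DecidableEquality (V G)
  decEq u v = map′ (pos-inj σ) (cong (pos σ)) (pos σ u ≟ pos σ v)

  edge-<⊎> : ∀ {x y} → E G x y → pos σ x < pos σ y ⊎ pos σ y < pos σ x
  edge-<⊎> {x} {y} e with <-cmp (pos σ x) (pos σ y)
  ... | tri< x<y _ _ = inj₁ x<y
  ... | tri≈ _ p _   = ⊥-elim (E-irr G (subst (E G x) (sym (pos-inj σ p)) e))
  ... | tri> _ _ y<x = inj₂ y<x

  maxPos : ℕ
  maxPos = Extrema.max 0 (map (pos σ) (vertices G))

  pos≤maxPos : ∀ v → pos σ v ≤ maxPos
  pos≤maxPos v = lookup (Extrema.xs≤max 0 _) (∈-map⁺ (pos σ) (complete G v))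

  reversed : VertexOrder G
  reversed = record
    { pos     = λ v → maxPos ∸ pos σ v
    ; pos-inj = λ p → pos-inj σ (∸-cancelˡ-≡ (pos≤maxPos _) (pos≤maxPos _) p)
    }

  reversed-<⁺ : ∀ {x y} → pos σ x < pos σ y → pos reversed y < pos reversed x
  reversed-<⁺ {x} {y} x<y = ∸-monoʳ-< x<y (pos≤maxPos y)

  reversed-<⁻ : ∀ {x y} → pos reversed x < pos reversed y → pos σ y < pos σ x
  reversed-<⁻ {x} {y} x<y with pos σ y <? pos σ x
  ... | yes y<x = y<x
  ... | no y≮x = ⊥-elim (<⇒≱ x<y (∸-monoʳ-≤ maxPos (≮⇒≥ y≮x)))

  reversed-stack : ∀ {k} {P : EdgePartition G k} → IsStackPartition σ P → IsStackPartition reversed P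
  reversed-stack {P = P} ok e₁ e₂ c (p , q , r) =
    ok (E-sym G e₂) (E-sym G e₁) (trans (sym (col-sym P e₂)) (trans (sym c) (col-sym P e₁)))
      (reversed-<⁻ r , reversed-<⁻ q , reversed-<⁻ p)

  reversed-queue : ∀ {k} {P : EdgePartition G k} → IsQueuePartition σ P → IsQueuePartition reversed P
  reversed-queue {P = P} ok e₁ e₂ c (p , q , r) =
    ok (E-sym G e₁) (E-sym G e₂) (trans (sym (col-sym P e₁)) (trans c (col-sym P e₂)))
      (reversed-<⁻ r , reversed-<⁻ q , reversed-<⁻ p)

  oriented : Bool → VertexOrder G
  oriented true  = σ
  oriented false = reversed

  oriented-opposite : ∀ {b b′} → b ≢ b′ → Opposite (oriented b) (oriented b′)
  oriented-opposite {true}  {true}  b≢b′ = ⊥-elim (b≢b′ refl)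
  oriented-opposite {true}  {false} _    = reversed-<⁺
  oriented-opposite {false} {true}  _    = reversed-<⁻
  oriented-opposite {false} {false} b≢b′ = ⊥-elim (b≢b′ refl)

  oriented≤maxPos : ∀ b x → pos (oriented b) x ≤ maxPos
  oriented≤maxPos true  x = pos≤maxPos x
  oriented≤maxPos false x = m∸n≤m maxPos (pos σ x)

  oriented-stack : ∀ {k} {P : EdgePartition G k} → IsStackPartition σ P → ∀ b → IsStackPartition (oriented b) P
  oriented-stack          ok true  = ok
  oriented-stack {P = P} ok false = reversed-stack {P = P} ok

  oriented-queue : ∀ {k} {P : EdgePartition G k} → IsQueuePartition σ P → ∀ b → IsQueuePartition (oriented b) P
  oriented-queue          ok true  = ok
  oriented-queue {P = P} ok false = reversed-queue {P = P} ok

[a*m+r]/m≡a : ∀ a {m r} .{{_ : NonZero m}} → r < m → (a * m + r) / m ≡ a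
[a*m+r]/m≡a a {m} {r} r<m = begin
  (a * m + r) / m   ≡⟨ +-distrib-/ (a * m) r (subst (_< m) (sym remainders) r<m) ⟩
  a * m / m + r / m ≡⟨ cong₂ _+_ (m*n/n≡m a m) (m<n⇒m/n≡0 r<m) ⟩
  a + 0             ≡⟨ +-identityʳ a ⟩
  a                 ∎
  where
  open ≡-Reasoning
  remainders : (a * m) % m + r % m ≡ r
  remainders = cong₂ _+_ (m*n%n≡0 a m) (m<n⇒m%n≡m r<m)

module Lexicographic {H G : Graph} (τ : VertexOrder H) (ρ : V H → VertexOrder G)
                     (N : ℕ) (ρ≤N : ∀ v x → pos (ρ v) x ≤ N) where

  -- Opaque, so that unification recovers the pair from `lexPos (v , x)`.
  opaque
    lexPos : V H × V G → ℕ
    lexPos (v , x) = pos τ v * suc N + pos (ρ v) x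

    lexPos/ : ∀ v x → lexPos (v , x) / suc N ≡ pos τ v
    lexPos/ v x = [a*m+r]/m≡a (pos τ v) (s≤s (ρ≤N v x))

    lexPos-injective : ∀ {w z} → lexPos w ≡ lexPos z → w ≡ z
    lexPos-injective {v , x} {u , y} p
      with refl ← pos-inj τ (trans (sym (lexPos/ v x)) (trans (cong (_/ suc N) p) (lexPos/ u y)))
      = cong (v ,_) (pos-inj (ρ v) (+-cancelˡ-≡ (pos τ v * suc N) _ _ p))

    lexPos-<-outer : ∀ {v x u y} → lexPos (v , x) < lexPos (u , y) → pos τ v ≤ pos τ u
    lexPos-<-outer {v} {x} {u} {y} p = begin
      pos τ v                   ≡⟨ lexPos/ v x ⟨
      lexPos (v , x) / suc N    ≤⟨ /-monoˡ-≤ (suc N) (<⇒≤ p) ⟩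
      lexPos (u , y) / suc N    ≡⟨ lexPos/ u y ⟩
      pos τ u                   ∎
      where open ≤-Reasoning

    lexPos-<-inner : ∀ {v x y} → lexPos (v , x) < lexPos (v , y) → pos (ρ v) x < pos (ρ v) y
    lexPos-<-inner {v} = +-cancelˡ-< (pos τ v * suc N) _ _

module _ {H : Graph} {d : ℕ} (D : DispersableStackLayout H d) where
  open DispersableStackLayout D renaming (order to τ; stacks to C)

  weaklyCrossing⇒sameEnds : ∀ {v₁ v₂ v₃ v₄} → E H v₁ v₃ → E H v₂ v₄ → col C v₁ v₃ ≡ col C v₂ v₄ →
    pos τ v₁ ≤ pos τ v₂ → pos τ v₂ ≤ pos τ v₃ → pos τ v₃ ≤ pos τ v₄ → v₁ ≡ v₂ × v₃ ≡ v₄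
  weaklyCrossing⇒sameEnds e₁ e₂ c p q r
    with m≤n⇒m<n∨m≡n p | m≤n⇒m<n∨m≡n q | m≤n⇒m<n∨m≡n r
  ... | inj₂ p₌ | _ | _ with refl ← pos-inj τ p₌ = refl , matching e₁ e₂ c
  ... | inj₁ p< | inj₂ q₌ | _ with refl ← pos-inj τ q₌ =
    ⊥-elim (<-irrefl (cong (pos τ) (matching (E-sym H e₁) e₂ (trans (sym (col-sym C e₁)) c)))
                     (<-≤-trans p< r))
  ... | inj₁ p< | inj₁ _ | inj₂ r₌ with refl ← pos-inj τ r₌ =
    ⊥-elim (<-irrefl (cong (pos τ) (matching (E-sym H e₁) (E-sym H e₂)
                                              (trans (sym (col-sym C e₁)) (trans c (col-sym C e₂)))))
                     p<)
  ... | inj₁ p< | inj₁ q< | inj₁ r< = ⊥-elim (valid e₁ e₂ c (p< , q< , r<))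

module _ {G : Graph} where

  opaque
    direction : VertexOrder G → V G → V G → Fin 2
    direction π x y with pos π x <? pos π y
    ... | yes _ = zero
    ... | no _  = suc zero

    direction-cong : ∀ {π π′ x y x′ y′} →
      (pos π x < pos π y → pos π′ x′ < pos π′ y′) → (pos π′ x′ < pos π′ y′ → pos π x < pos π y) →
      direction π x y ≡ direction π′ x′ y′
    direction-cong {π} {π′} {x} {y} {x′} {y′} to from with pos π x <? pos π y | pos π′ x′ <? pos π′ y′
    ... | yes _ | yes _ = refl
    ... | no _  | no _  = refl
    ... | yes a | no b  = ⊥-elim (b (to a))
    ... | no a  | yes b = ⊥-elim (a (from b))

    sameDirection-< : ∀ {π π′ x y x′ y′} → direction π x y ≡ direction π′ x′ y′ →
      pos π x < pos π y → pos π′ x′ < pos π′ y′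
    sameDirection-< {π} {π′} {x} {y} {x′} {y′} same x<y with pos π x <? pos π y | pos π′ x′ <? pos π′ y′
    ... | _     | yes x′<y′ = x′<y′
    ... | yes _ | no _      = ⊥-elim (0F≢1+n same)
    ... | no x≮y | no _     = ⊥-elim (x≮y x<y)

  module _ (π : VertexOrder G) {q : ℕ} {Q : EdgePartition G q} (Q-queue : IsQueuePartition π Q) where

    -- According to the common direction, x₁ < x₂ < x₄ < x₃ or x₄ < x₃ < x₁ < x₂ is a nesting.
    sameQueue-sameDirection⇒¬inverted : ∀ {x₁ x₂ x₃ x₄} → E G x₁ x₃ → E G x₂ x₄ → col Q x₁ x₃ ≡ col Q x₂ x₄ →
      direction π x₁ x₃ ≡ direction π x₂ x₄ → pos π x₁ < pos π x₂ → pos π x₄ < pos π x₃ → ⊥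
    sameQueue-sameDirection⇒¬inverted e₁ e₂ c same p r with edge-<⊎> π e₁
    ... | inj₁ x₁<x₃ = Q-queue e₁ e₂ c (p , sameDirection-< same x₁<x₃ , r)
    ... | inj₂ x₃<x₁ =
      Q-queue (E-sym G e₂) (E-sym G e₁) (trans (sym (col-sym Q e₂)) (trans (sym c) (col-sym Q e₁)))
        (r , x₃<x₁ , p)

record StackColouring {W : Set} (position : W → ℕ) (R : Rel W 0ℓ) (k : ℕ) : Set where
  field
    colour       : W → W → Fin k
    colour-sym   : ∀ {u v} → R u v → colour u v ≡ colour v u
    non-crossing : ∀ {u v x y} → R u v → R x y → colour u v ≡ colour x y →
                   ¬ (position u < position x × position x < position v × position v < position y)
open StackColouring

stackLayout : (G : Graph) {k : ℕ} (position : V G → ℕ) → (∀ {u v} → position u ≡ position v → u ≡ v) →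
  StackColouring position (E G) k → StackLayout G k
stackLayout G position injective S = record
  { order  = record { pos = position ; pos-inj = injective }
  ; stacks = record { col = colour S ; col-sym = colour-sym S }
  ; valid  = non-crossing S
  }

module _ {W : Set} {position : W → ℕ} {R₁ R₂ T : Rel W 0ℓ}
         (T? : Decidable T) (T-sym : Symmetric T) (R₁⇒T : R₁ ⇒ T) (R₂⇒¬T : ∀ {u v} → R₂ u v → ¬ T u v)
         {k₁ k₂ : ℕ} (C₁ : StackColouring position R₁ k₁) (C₂ : StackColouring position R₂ k₂) where

  private
    pick : W → W → Fin k₁ ⊎ Fin k₂
    pick u v with T? u v
    ... | yes _ = inj₁ (colour C₁ u v)
    ... | no _  = inj₂ (colour C₂ u v)

    pick-T : ∀ {u v} → T u v → pick u v ≡ inj₁ (colour C₁ u v)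
    pick-T {u} {v} t with T? u v
    ... | yes _ = refl
    ... | no ¬t = ⊥-elim (¬t t)

    pick-¬T : ∀ {u v} → ¬ T u v → pick u v ≡ inj₂ (colour C₂ u v)
    pick-¬T {u} {v} ¬t with T? u v
    ... | yes t = ⊥-elim (¬t t)
    ... | no _  = refl

    pick-R₁ : ∀ {u v} → R₁ u v → pick u v ≡ inj₁ (colour C₁ u v)
    pick-R₁ r = pick-T (R₁⇒T r)

    pick-R₂ : ∀ {u v} → R₂ u v → pick u v ≡ inj₂ (colour C₂ u v)
    pick-R₂ r = pick-¬T (R₂⇒¬T r)

    samePick : ∀ {u v x y} → join k₁ k₂ (pick u v) ≡ join k₁ k₂ (pick x y) → pick u v ≡ pick x y
    samePick c = trans (sym (splitAt-join k₁ k₂ _)) (trans (cong (splitAt k₁) c) (splitAt-join k₁ k₂ _))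

    pick-sym : ∀ {u v} → (R₁ ∪ R₂) u v → pick u v ≡ pick v u
    pick-sym {u} {v} (inj₁ r) = begin
      pick u v                ≡⟨ pick-R₁ r ⟩
      inj₁ (colour C₁ u v)    ≡⟨ cong inj₁ (colour-sym C₁ r) ⟩
      inj₁ (colour C₁ v u)    ≡⟨ pick-T (T-sym (R₁⇒T r)) ⟨
      pick v u                ∎
      where open ≡-Reasoning
    pick-sym {u} {v} (inj₂ r) = begin
      pick u v                ≡⟨ pick-R₂ r ⟩
      inj₂ (colour C₂ u v)    ≡⟨ cong inj₂ (colour-sym C₂ r) ⟩
      inj₂ (colour C₂ v u)    ≡⟨ pick-¬T (λ t → R₂⇒¬T r (T-sym t)) ⟨
      pick v u                ∎
      where open ≡-Reasoning

  splitBy : StackColouring position (R₁ ∪ R₂) (k₁ + k₂)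
  splitBy .colour u v = join k₁ k₂ (pick u v)
  splitBy .colour-sym r = cong (join k₁ k₂) (pick-sym r)
  splitBy .non-crossing (inj₁ r) (inj₁ r′) c =
    non-crossing C₁ r r′ (inj₁-injective (trans (sym (pick-R₁ r)) (trans (samePick c) (pick-R₁ r′))))
  splitBy .non-crossing (inj₁ r) (inj₂ r′) c =
    contradiction (trans (sym (pick-R₁ r)) (trans (samePick c) (pick-R₂ r′))) λ ()
  splitBy .non-crossing (inj₂ r) (inj₁ r′) c =
    contradiction (trans (sym (pick-R₂ r)) (trans (samePick c) (pick-R₁ r′))) λ ()
  splitBy .non-crossing (inj₂ r) (inj₂ r′) c =
    non-crossing C₂ r r′ (inj₂-injective (trans (sym (pick-R₂ r)) (trans (samePick c) (pick-R₂ r′))))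

module ProductColourings {H G : Graph} (bipartite : Bipartite H) {d : ℕ} (D : DispersableStackLayout H d)
                         (σ : VertexOrder G) where
  open DispersableStackLayout D renaming (order to τ; stacks to C)

  side : V H → Bool
  side = proj₁ bipartite

  block : V H → VertexOrder G
  block v = oriented σ (side v)

  opposite-blocks : ∀ {v u} → E H v u → Opposite (block v) (block u)
  opposite-blocks e = oriented-opposite σ (proj₂ bipartite e)

  open Lexicographic τ block (maxPos σ) (λ v → oriented≤maxPos σ (side v)) public

  SameRow SameColumn : Rel (V H × V G) 0ℓ
  SameRow    (v , _) (u , _) = v ≡ u
  SameColumn (_ , x) (_ , y) = x ≡ y

  sameRow? : Decidable SameRow
  sameRow? (v , _) (u , _) = decEq τ v u

  sameColumn? : Decidable SameColumn
  sameColumn? (_ , x) (_ , y) = decEq σ x y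

  BEdge⇒¬SameRow : ∀ {w z} → BEdge H G w z → ¬ SameRow w z
  BEdge⇒¬SameRow (_ , e) refl = E-irr H e

  DEdge⇒¬SameRow : ∀ {w z} → DEdge H G w z → ¬ SameRow w z
  DEdge⇒¬SameRow (e , _) refl = E-irr H e

  DEdge⇒¬SameColumn : ∀ {w z} → DEdge H G w z → ¬ SameColumn w z
  DEdge⇒¬SameColumn (_ , e) refl = E-irr G e

  AColouring : ∀ {s} (S : EdgePartition G s) → IsStackPartition σ S →
               StackColouring lexPos (AEdge H G) s
  AColouring S _ .colour (_ , x) (_ , y) = col S x y
  AColouring S _ .colour-sym (_ , e) = col-sym S e
  AColouring S S-stack .non-crossing {v₁ , _} (refl , e₁) (refl , e₂) c (p₁ , p₂ , p₃)
    with refl ← pos-inj τ (≤-antisym (lexPos-<-outer p₁) (lexPos-<-outer p₂))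
    = oriented-stack σ {P = S} S-stack (side v₁) e₁ e₂ c
        (lexPos-<-inner p₁ , lexPos-<-inner p₂ , lexPos-<-inner p₃)

  BColouring : StackColouring lexPos (BEdge H G) d
  BColouring .colour (v , _) (u , _) = col C v u
  BColouring .colour-sym (_ , e) = col-sym C e
  BColouring .non-crossing (refl , e₁) (refl , e₂) c (p₁ , p₂ , p₃)
    with refl , refl ← weaklyCrossing⇒sameEnds D e₁ e₂ c
                         (lexPos-<-outer p₁) (lexPos-<-outer p₂) (lexPos-<-outer p₃)
    = <-asym (lexPos-<-inner p₃) (opposite-blocks e₁ (lexPos-<-inner p₁))

  module _ {q : ℕ} (Q : EdgePartition G q) (Q-queue : IsQueuePartition σ Q) where

    directColour : V H × V G → V H × V G → Fin (2 * q * d)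
    directColour (v , x) (u , y) = combine (combine (direction (block v) x y) (col Q x y)) (col C v u)

    directColour-injective : ∀ v x u y v′ x′ u′ y′ →
      directColour (v , x) (u , y) ≡ directColour (v′ , x′) (u′ , y′) →
      direction (block v) x y ≡ direction (block v′) x′ y′ × col Q x y ≡ col Q x′ y′ × col C v u ≡ col C v′ u′
    directColour-injective v x u y v′ x′ u′ y′ c
      with c′ , cC ← combine-injective (combine (direction (block v) x y) (col Q x y)) (col C v u)
                                       (combine (direction (block v′) x′ y′) (col Q x′ y′)) (col C v′ u′) c
      with cDirection , cQ ← combine-injective _ _ _ _ c′
      = cDirection , cQ , cC

    DColouring : StackColouring lexPos (DEdge H G) (2 * q * d)
    DColouring .colour = directColour
    DColouring .colour-sym {v , x} {u , y} (eH , eG) =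
      cong₂ combine
        (cong₂ combine (direction-cong (opposite-blocks eH) (opposite-blocks (E-sym H eH))) (col-sym Q eG))
        (col-sym C eH)
    DColouring .non-crossing {v₁ , x₁} {v₃ , x₃} {v₂ , x₂} {v₄ , x₄} (h₁ , g₁) (h₂ , g₂) c (p₁ , p₂ , p₃)
      with cDirection , cQ , cC ← directColour-injective v₁ x₁ v₃ x₃ v₂ x₂ v₄ x₄ c
      with refl , refl ← weaklyCrossing⇒sameEnds D h₁ h₂ cC
                           (lexPos-<-outer p₁) (lexPos-<-outer p₂) (lexPos-<-outer p₃)
      = sameQueue-sameDirection⇒¬inverted (block v₁) {Q = Q} (oriented-queue σ {P = Q} Q-queue (side v₁))
          g₁ g₂ cQ cDirection (lexPos-<-inner p₁) (opposite-blocks (E-sym H h₁) (lexPos-<-inner p₃))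

theorem1 : (H G : Graph) (s q d : ℕ) → Bipartite H → SimultaneousLayout G s q → IsDsn H d →
    SnAtMost (H □ G) (s + d)
    × SnAtMost (H ⨯ G) (2 * q * d)
    × SnAtMost (H ⊠ G) (2 * q * d + s + d)
theorem1 H G s q d bipartite L (D , _) =
    (s + d , ≤-refl , stackLayout (H □ G) lexPos lexPos-injective cartesian)
  , (2 * q * d , ≤-refl , stackLayout (H ⨯ G) lexPos lexPos-injective direct)
  , (s + (d + 2 * q * d) , ≤-reflexive count , stackLayout (H ⊠ G) lexPos lexPos-injective strong)
  where
  open SimultaneousLayout L
  open ProductColourings bipartite D order

  cartesian : StackColouring lexPos (AEdge H G ∪ BEdge H G) (s + d)
  cartesian = splitBy sameRow? sym proj₁ BEdge⇒¬SameRow (AColouring stacks stacksOK) BColouring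

  direct : StackColouring lexPos (DEdge H G) (2 * q * d)
  direct = DColouring queues queuesOK

  strong : StackColouring lexPos (AEdge H G ∪ (BEdge H G ∪ DEdge H G)) (s + (d + 2 * q * d))
  strong = splitBy sameRow? sym proj₁ [ BEdge⇒¬SameRow , DEdge⇒¬SameRow ] (AColouring stacks stacksOK)
             (splitBy sameColumn? sym proj₁ DEdge⇒¬SameColumn BColouring (DColouring queues queuesOK))

  count : s + (d + 2 * q * d) ≡ 2 * q * d + s + d
  count = trans (sym (+-assoc s d _)) (trans (+-comm (s + d) _) (sym (+-assoc _ s d)))
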